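{- Let $\theta \in \mathcal{L}$ be such that there exists a multi-agent epistemic Hintikka structure for $\theta$. Then $\theta$ is satisfiable in a multi-agent epistemic model, i.e., $\mathcal{M},s\models\theta$ for some MAEM $\mathcal{M}$ and some state $s$ of $\mathcal{M}$.
   Context: Fix a nonempty set $\mathbf{AP}$ of atomic propositions and a finite set $\Sigma$ of agents with at least two elements. The language $\mathcal{L}$ is given by $\varphi ::= p \mid \neg\varphi \mid \varphi_1 \wedge \varphi_2 \mid K_a\varphi \mid D\varphi \mid C\varphi$, with $p \in \mathbf{AP}$, $a \in \Sigma$. A multi-agent epistemic structure (MAES) is a tuple $(\Sigma, S, \{R_a\}_{a\in\Sigma}, R_D, R_C)$ with $S\neq\emptyset$, $R_a, R_D$ binary relations on $S$, and $R_C$ the transitive closure of $R_D \cup \bigcup_{a} R_a$. A multi-agent epistemic model (MAEM) is such a structure in which every $R_a$ and $R_D$ is an equivalence relation and $R_D = \bigcap_{a \in \Sigma} R_a$, together with a labeling $L : S \to \mathcal{P}(\mathbf{AP})$. Satisfaction is standard: $p$ holds at $s$ iff $p\in L(s)$, Booleans as usual, $\mathcal{M},s\models K_a\varphi$ iff $\varphi$ holds at all $t$ with $(s,t)\in R_a$, and similarly $D$ with $R_D$ and $C$ with $R_C$. A set $\Delta \subseteq \mathcal{L}$ is fully expanded if: $\neg\neg\varphi\in\Delta$ implies $\varphi\in\Delta$; $\varphi\wedge\psi\in\Delta$ implies $\varphi,\psi\in\Delta$; $\neg(\varphi\wedge\psi)\in\Delta$ implies $\neg\varphi\in\Delta$ or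 $\neg\psi\in\Delta$; $K_a\varphi\in\Delta$ implies $D\varphi\in\Delta$; $D\varphi\in\Delta$ implies $\varphi\in\Delta$; $C\varphi\in\Delta$ implies $K_a(\varphi\wedge C\varphi)\in\Delta$ for every $a\in\Sigma$; $\neg C\varphi\in\Delta$ implies $\neg K_a(\varphi\wedge C\varphi)\in\Delta$ for some $a\in\Sigma$; and if $\varphi\in\Delta$ and $\psi$ is a subformula of $\varphi$ of the form $K_a\chi$ or $D\chi$, then $\psi\in\Delta$ or $\neg\psi\in\Delta$. A multi-agent epistemic Hintikka structure (MAEHS) is a tuple $(\Sigma, S, \{R_a\}, R_D, R_C, H)$ where $(\Sigma,S,\{R_a\},R_D,R_C)$ is a MAES and $H$ assigns to each $s\in S$ a set $H(s)\subseteq\mathcal{L}$ such that: (H1) if $\neg\varphi\in H(s)$ then $\varphi\notin H(s)$; (H2) each $H(s)$ is fully expanded; (H3) if $K_a\varphi\in H(s)$ and $(s,t)\in R_a$ then $\varphi\in H(t)$; (H4) if $\neg K_a\varphi\in H(s)$ then there is $t$ with $(s,t)\in R_a$ and $\neg\varphi\in H(t)$; (H5) if $(s,t)\in R_a$ then $K_a\varphi\in H(s)$ iff $K_a\varphi\in H(t)$; (H6) if $D\varphi\in H(s)$ and $(s,t)\in R_D$ then $\varphi\in H(t)$; (H7) if $\neg D\varphi\in H(s)$ then there is $t$ with $(s,t)\in R_D$ and $\neg\varphi\in H(t)$; (H8) if $(s,t)\in R_D$ then $D\varphi\in H(s)$ iff $D\varphi\in H(t)$, and $K_a\varphi\in H(s)$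 iff $K_a\varphi\in H(t)$ for every $a\in\Sigma$; (H9) if $\neg C\varphi\in H(s)$ then there is $t$ with $(s,t)\in R_C$ and $\neg\varphi\in H(t)$. It is a MAEHS for $\theta$ if $\theta\in H(s)$ for some $s\in S$. -}

module Defs where

open import Level using (0ℓ)
open import Data.Nat using (ℕ)
open import Data.Fin using (Fin)
open import Data.Product using (Σ; _×_; _,_)
open import Data.Sum using (_⊎_)
open import Data.Empty using (⊥)
open import Relation.Nullary using (¬_)
open import Relation.Binary using (Rel; IsEquivalence)
open import Relation.Binary.Construct.Closure.Transitive using (TransClosure)

data Form (AP : Set) (n : ℕ) : Set where
  atom : AP → Form AP n
  ¬ᶠ_  : Form AP n → Form AP n
  _∧ᶠ_ : Form AP n → Form AP n → Form AP n
  K    : Fin n → Form AP n → Form AP n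
  D    : Form AP n → Form AP n
  C    : Form AP n → Form AP n

data Sub {AP : Set} {n : ℕ} : Form AP n → Form AP n → Set where
  sub-refl : ∀ {φ} → Sub φ φ
  sub-¬    : ∀ {ψ φ} → Sub ψ φ → Sub ψ (¬ᶠ φ)
  sub-∧ˡ   : ∀ {ψ φ χ} → Sub ψ φ → Sub ψ (φ ∧ᶠ χ)
  sub-∧ʳ   : ∀ {ψ φ χ} → Sub ψ χ → Sub ψ (φ ∧ᶠ χ)
  sub-K    : ∀ {ψ a φ} → Sub ψ φ → Sub ψ (K a φ)
  sub-D    : ∀ {ψ φ} → Sub ψ φ → Sub ψ (D φ)
  sub-C    : ∀ {ψ φ} → Sub ψ φ → Sub ψ (C φ)

record MAES (n : ℕ) : Set₁ where
  field
    S   : Set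
    R   : Fin n → Rel S 0ℓ
    RD  : Rel S 0ℓ
  RUnion : Rel S 0ℓ
  RUnion s t = RD s t ⊎ Σ (Fin n) (λ a → R a s t)
  RC : Rel S 0ℓ
  RC = TransClosure RUnion

record MAEM (AP : Set) (n : ℕ) : Set₁ where
  field
    struct : MAES n
  open MAES struct public
  field
    R-equiv  : (a : Fin n) → IsEquivalence (R a)
    RD-equiv : IsEquivalence RD
    RD-inter : ∀ s t → (RD s t → ∀ a → R a s t) × ((∀ a → R a s t) → RD s t)
    L        : S → AP → Set

_,_⊨_ : ∀ {AP n} (M : MAEM AP n) → MAEM.S M → Form AP n → Set
M , s ⊨ atom p  = MAEM.L M s p
M , s ⊨ (¬ᶠ φ)  = ¬ (M , s ⊨ φ)
M , s ⊨ (φ ∧ᶠ ψ) = (M , s ⊨ φ) × (M , s ⊨ ψ)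
M , s ⊨ K a φ   = ∀ t → MAEM.R M a s t → M , t ⊨ φ
M , s ⊨ D φ     = ∀ t → MAEM.RD M s t → M , t ⊨ φ
M , s ⊨ C φ     = ∀ t → MAEM.RC M s t → M , t ⊨ φ

record FullyExpanded {AP : Set} {n : ℕ} (Δ : Form AP n → Set) : Set where
  field
    fe-¬¬  : ∀ φ → Δ (¬ᶠ (¬ᶠ φ)) → Δ φ
    fe-∧   : ∀ φ ψ → Δ (φ ∧ᶠ ψ) → Δ φ × Δ ψ
    fe-¬∧  : ∀ φ ψ → Δ (¬ᶠ (φ ∧ᶠ ψ)) → Δ (¬ᶠ φ) ⊎ Δ (¬ᶠ ψ)
    fe-K   : ∀ a φ → Δ (K a φ) → Δ (D φ)
    fe-D   : ∀ φ → Δ (D φ) → Δ φ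
    fe-C   : ∀ φ → Δ (C φ) → ∀ a → Δ (K a (φ ∧ᶠ C φ))
    fe-¬C  : ∀ φ → Δ (¬ᶠ (C φ)) → Σ (Fin n) (λ a → Δ (¬ᶠ (K a (φ ∧ᶠ C φ))))
    fe-subK : ∀ φ a χ → Δ φ → Sub (K a χ) φ → Δ (K a χ) ⊎ Δ (¬ᶠ (K a χ))
    fe-subD : ∀ φ χ → Δ φ → Sub (D χ) φ → Δ (D χ) ⊎ Δ (¬ᶠ (D χ))

record MAEHS (AP : Set) (n : ℕ) : Set₁ where
  field
    struct : MAES n
  open MAES struct public
  field
    H  : S → Form AP n → Set
    H1 : ∀ s φ → H s (¬ᶠ φ) → ¬ H s φ
    H2 : ∀ s → FullyExpanded (H s)
    H3 : ∀ s t a φ → H s (K a φ) → R a s t → H t φ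
    H4 : ∀ s a φ → H s (¬ᶠ (K a φ)) → Σ S (λ t → R a s t × H t (¬ᶠ φ))
    H5 : ∀ s t a φ → R a s t → (H s (K a φ) → H t (K a φ)) × (H t (K a φ) → H s (K a φ))
    H6 : ∀ s t φ → H s (D φ) → RD s t → H t φ
    H7 : ∀ s φ → H s (¬ᶠ (D φ)) → Σ S (λ t → RD s t × H t (¬ᶠ φ))
    H8 : ∀ s t → RD s t →
           (∀ φ → (H s (D φ) → H t (D φ)) × (H t (D φ) → H s (D φ)))
         × (∀ a φ → (H s (K a φ) → H t (K a φ)) × (H t (K a φ) → H s (K a φ)))
    H9 : ∀ s φ → H s (¬ᶠ (C φ)) → Σ S (λ t → RC s t × H t (¬ᶠ φ))

MAEHSFor : ∀ {AP n} → Form AP n → Set₁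
MAEHSFor {AP} {n} θ = Σ (MAEHS AP n) (λ 𝓗 → Σ (MAEHS.S 𝓗) (λ s → MAEHS.H 𝓗 s θ))

SatisfiableMAEM : ∀ {AP n} → Form AP n → Set₁
SatisfiableMAEM {AP} {n} θ = Σ (MAEM AP n) (λ M → Σ (MAEM.S M) (λ s → M , s ⊨ θ))

-- Worlds of the model are Hintikka states x together with a colouring of the agents
-- by pairs (height, state). R_a relates worlds whose states agree on all K_a-formulas
-- and which give agent a the same colour; R_D is the intersection of the R_a. The
-- agent of strictly greatest height is the leader, and its colour must carry a state
-- with the same D-formulas as x. R_D-related worlds share every colour, hence the
-- leader, hence their D-formulas. Conversely an R_a-successor may recolour an agent
-- b ≠ a with a fresh greatest height and the target state, so every R_a-step and
-- R_D-step of the Hintikka structure lifts; this is where two agents are needed.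
-- A truth lemma by induction on formulas then turns membership in H into satisfaction.
module Submission where

open import Defs
open import Data.Nat using (ℕ; suc; _≤_; _<_; s≤s)
open import Data.Nat.Properties using (<-asym; ≤-refl)
open import Data.Fin using (Fin; _≟_; punchIn) renaming (zero to fzero)
open import Data.Fin.Properties using (punchInᵢ≢i)
open import Data.List using (tabulate)
open import Data.List.Extrema.Nat using (max; v≤max⁺)
open import Data.List.Relation.Unary.Any.Properties using (tabulate⁺)
open import Data.Vec.Functional using (Vector; updateAt)
open import Data.Vec.Functional.Properties using (updateAt-updates; updateAt-minimal)
open import Data.Product using (∃; _×_; _,_; proj₁; proj₂; map; uncurry)
open import Data.Sum using (inj₁; inj₂; [_,_]′)
open import Function using (_∘_; id; const; _⇔_; mk⇔; Equivalence)
open import Function.Properties.Equivalence using (⇔-isEquivalence)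
open import Level using (0ℓ)
open import Relation.Nullary using (¬_)
open import Relation.Nullary.Decidable using (decidable-stable)
open import Relation.Binary using (Rel; IsEquivalence)
import Relation.Binary.Construct.On as On
open import Relation.Binary.Construct.Closure.Transitive using (TransClosure; [_]; _∷_)
open import Relation.Binary.PropositionalEquality
  using (_≡_; _≢_; _≗_; refl; sym; trans; cong; subst; subst₂; ≢-sym; module ≡-Reasoning)

⋂-isEquivalence : {I A : Set} {R : I → Rel A 0ℓ} →
                  (∀ i → IsEquivalence (R i)) → IsEquivalence (λ x y → ∀ i → R i x y)
⋂-isEquivalence eq = record
  { refl  = λ i → IsEquivalence.refl (eq i)
  ; sym   = λ r i → IsEquivalence.sym (eq i) (r i)
  ; trans = λ r r′ i → IsEquivalence.trans (eq i) (r i) (r′ i)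
  }

-- The back condition of a bounded morphism f.
record Back {A B : Set} (f : B → A) (_∼_ : Rel A 0ℓ) (_≈_ : Rel B 0ℓ) : Set where
  field
    lift : ∀ {u t} → f u ∼ t → ∃ λ w → u ≈ w × f w ≡ t

  witness : ∀ {P : A → Set} {u} → (∃ λ t → f u ∼ t × P t) → ∃ λ w → u ≈ w × P (f w)
  witness {P} (t , r , pt) with lift r
  ... | w , u≈w , fw≡t = w , u≈w , subst P (sym fw≡t) pt

open Back

Back-TransClosure : {A B : Set} {f : B → A} {_∼_ : Rel A 0ℓ} {_≈_ : Rel B 0ℓ} →
                    Back f _∼_ _≈_ → Back f (TransClosure _∼_) (TransClosure _≈_)
Back-TransClosure {f = f} {_∼_} {_≈_} back = record { lift = lift⁺ }
  where
  lift⁺ : ∀ {u t} → TransClosure _∼_ (f u) t → ∃ λ w → TransClosure _≈_ u w × f w ≡ t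
  lift⁺ [ r ] = map id (map [_] id) (lift back r)
  lift⁺ (r ∷ p) with lift back r
  ... | w , u≈w , refl = map id (map (u≈w ∷_) id) (lift⁺ p)

IsStrictMax : ∀ {n} → (Fin n → ℕ) → Fin n → Set
IsStrictMax f b = ∀ a → a ≢ b → f a < f b

IsStrictMax-unique : ∀ {n} {f g : Fin n → ℕ} {b c} →
                     f ≗ g → IsStrictMax f b → IsStrictMax g c → b ≡ c
IsStrictMax-unique {b = b} {c} f≗g max-b max-c = decidable-stable (b ≟ c) λ b≢c →
  <-asym (max-b c (≢-sym b≢c)) (subst₂ _<_ (sym (f≗g b)) (sym (f≗g c)) (max-c b b≢c))

strictUpperBound : ∀ {n} → (Fin n → ℕ) → ℕ
strictUpperBound f = suc (max 0 (tabulate f))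

<-strictUpperBound : ∀ {n} (f : Fin n → ℕ) a → f a < strictUpperBound f
<-strictUpperBound f a = s≤s (v≤max⁺ 0 (tabulate f) (inj₂ (tabulate⁺ a ≤-refl)))

promote : ∀ {X : Set} {n} → Vector (ℕ × X) n → Fin n → X → Vector (ℕ × X) n
promote c b x = updateAt c b (const (strictUpperBound (proj₁ ∘ c) , x))

promote-isStrictMax : ∀ {X : Set} {n} (c : Vector (ℕ × X) n) b x →
                      IsStrictMax (proj₁ ∘ promote c b x) b
promote-isStrictMax c b x a a≢b =
  subst₂ (λ ca cb → proj₁ ca < proj₁ cb)
         (sym (updateAt-minimal a b c a≢b)) (sym (updateAt-updates b c))
         (<-strictUpperBound (proj₁ ∘ c) a)

K-reflexive : ∀ {AP n} {Δ : Form AP n → Set} {a φ} → FullyExpanded Δ → Δ (K a φ) → Δ φ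
K-reflexive {a = a} {φ} fe = fe-D φ ∘ fe-K a φ
  where open FullyExpanded fe

module Unravelling {AP : Set} {n : ℕ} (𝓗 : MAEHS AP n)
                   (other : Fin n → Fin n) (other≢ : ∀ a → other a ≢ a) where

  open MAEHS 𝓗
  open FullyExpanded

  Agree : (Form AP n → Form AP n) → Rel S 0ℓ
  Agree op x y = ∀ ψ → H x (op ψ) ⇔ H y (op ψ)

  Agree-isEquivalence : ∀ op → IsEquivalence (Agree op)
  Agree-isEquivalence op = ⋂-isEquivalence λ ψ → On.isEquivalence (λ x → H x (op ψ)) ⇔-isEquivalence

  SameK : Fin n → Rel S 0ℓ
  SameK a = Agree (K a)

  SameD : Rel S 0ℓ
  SameD = Agree D

  module SameD = IsEquivalence (Agree-isEquivalence D)

  Colour : Set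
  Colour = ℕ × S

  record World : Set where
    constructor world
    field
      state        : S
      colour       : Vector Colour n
      leader       : Fin n
      leader-max   : IsStrictMax (proj₁ ∘ colour) leader
      leader-sameD : SameD state (proj₂ (colour leader))

    representative : S
    representative = proj₂ (colour leader)

  open World

  ledWorld : Vector Colour n → Fin n → S → World
  ledWorld c b t = world t (promote c b t) b (promote-isStrictMax c b t)
    (SameD.reflexive (sym (cong proj₂ (updateAt-updates b c))))

  record Rᵐ (a : Fin n) (u w : World) : Set where
    constructor related
    field
      sameK      : SameK a (state u) (state w)
      sameColour : colour u a ≡ colour w a

  Rᵐ-isEquivalence : ∀ a → IsEquivalence (Rᵐ a)
  Rᵐ-isEquivalence a = record
    { refl  = related SameK.refl refl
    ; sym   = λ (related k e) → related (SameK.sym k) (sym e)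
    ; trans = λ (related k e) (related k′ e′) → related (SameK.trans k k′) (trans e e′)
    }
    where module SameK = IsEquivalence (Agree-isEquivalence (K a))

  model : MAEM AP n
  model = record
    { struct   = record { S = World ; R = Rᵐ ; RD = λ u w → ∀ a → Rᵐ a u w }
    ; R-equiv  = Rᵐ-isEquivalence
    ; RD-equiv = ⋂-isEquivalence Rᵐ-isEquivalence
    ; RD-inter = λ _ _ → id , id
    ; L        = λ w p → H (state w) (atom p)
    }

  open MAEM model using () renaming (RD to RDᵐ; RUnion to RUnionᵐ; RC to RCᵐ)

  RDᵐ⇒same-representative : ∀ {u w} → RDᵐ u w → representative u ≡ representative w
  RDᵐ⇒same-representative {u} {w} r = begin
    proj₂ (colour u (leader u)) ≡⟨ cong proj₂ (Rᵐ.sameColour (r (leader u))) ⟩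
    proj₂ (colour w (leader u)) ≡⟨ cong (proj₂ ∘ colour w) same-leader ⟩
    proj₂ (colour w (leader w)) ∎
    where
    open ≡-Reasoning
    same-leader : leader u ≡ leader w
    same-leader = IsStrictMax-unique (λ a → cong proj₁ (Rᵐ.sameColour (r a))) (leader-max u) (leader-max w)

  RDᵐ⇒SameD : ∀ {u w} → RDᵐ u w → SameD (state u) (state w)
  RDᵐ⇒SameD {u} {w} r = SameD.trans (leader-sameD u)
    (SameD.trans (SameD.reflexive (RDᵐ⇒same-representative r)) (SameD.sym (leader-sameD w)))

  K-forward : ∀ {a φ u w} → Rᵐ a u w → H (state u) (K a φ) → H (state w) φ
  K-forward {φ = φ} {w = w} (related sameK _) = K-reflexive (H2 (state w)) ∘ Equivalence.to (sameK φ)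

  D-forward : ∀ {φ u w} → RDᵐ u w → H (state u) (D φ) → H (state w) φ
  D-forward {φ} {w = w} r = fe-D (H2 (state w)) φ ∘ Equivalence.to (RDᵐ⇒SameD r φ)

  C-step : ∀ {φ u w} → RUnionᵐ u w → H (state u) (C φ) → H (state w) (φ ∧ᶠ C φ)
  C-step {φ} {u} (inj₁ r)       h = K-forward (r (leader u)) (fe-C (H2 (state u)) φ h (leader u))
  C-step {φ} {u} (inj₂ (a , r)) h = K-forward r (fe-C (H2 (state u)) φ h a)

  C-forward : ∀ {φ u w} → RCᵐ u w → H (state u) (C φ) → H (state w) φ
  C-forward {φ} {w = w} [ r ]   h = proj₁ (fe-∧ (H2 (state w)) φ (C φ) (C-step r h))
  C-forward {φ} (_∷_ {y = v} r p) h = C-forward p (proj₂ (fe-∧ (H2 (state v)) φ (C φ) (C-step r h)))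

  back-K : ∀ a → Back state (R a) (Rᵐ a)
  lift (back-K a) {u} {t} r =
    ledWorld (colour u) (other a) t ,
    related (λ ψ → uncurry mk⇔ (H5 (state u) t a ψ r))
            (sym (updateAt-minimal a (other a) (colour u) (≢-sym (other≢ a)))) ,
    refl

  back-D : Back state RD RDᵐ
  lift back-D {world x c b b-max x≈b} {t} r =
    world t c b b-max (SameD.trans (SameD.sym (uncurry mk⇔ ∘ proj₁ (H8 x t r))) x≈b) ,
    (λ a → related (λ ψ → uncurry mk⇔ (proj₂ (H8 x t r) a ψ)) refl) ,
    refl

  back-C : Back state RC RCᵐ
  back-C = Back-TransClosure record { lift = λ where
    (inj₁ r)       → map id (map inj₁ id) (lift back-D r)
    (inj₂ (a , r)) → map id (map (inj₂ ∘ (a ,_)) id) (lift (back-K a) r) }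

  mutual
    truth⁺ : ∀ φ {w} → H (state w) φ → model , w ⊨ φ
    truth⁺ (atom p)  h       = h
    truth⁺ (¬ᶠ φ)    h       = truth⁻ φ h
    truth⁺ (φ ∧ᶠ ψ) {w} h    = map (truth⁺ φ) (truth⁺ ψ) (fe-∧ (H2 (state w)) φ ψ h)
    truth⁺ (K a φ)   h v r   = truth⁺ φ (K-forward r h)
    truth⁺ (D φ)     h v r   = truth⁺ φ (D-forward r h)
    truth⁺ (C φ)     h v p   = truth⁺ φ (C-forward p h)

    truth⁻ : ∀ φ {w} → H (state w) (¬ᶠ φ) → ¬ (model , w ⊨ φ)
    truth⁻ (atom p) {w} h                = H1 (state w) (atom p) h
    truth⁻ (¬ᶠ φ) {w} h ⊭φ               = ⊭φ (truth⁺ φ (fe-¬¬ (H2 (state w)) φ h))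
    truth⁻ (φ ∧ᶠ ψ) {w} h (⊨φ , ⊨ψ)      =
      [ (λ h¬φ → truth⁻ φ h¬φ ⊨φ) , (λ h¬ψ → truth⁻ ψ h¬ψ ⊨ψ) ]′ (fe-¬∧ (H2 (state w)) φ ψ h)
    truth⁻ (K a φ) {w} h ⊨Kφ with witness (back-K a) (H4 (state w) a φ h)
    ... | v , r , h¬φ = truth⁻ φ h¬φ (⊨Kφ v r)
    truth⁻ (D φ) {w} h ⊨Dφ with witness back-D (H7 (state w) φ h)
    ... | v , r , h¬φ = truth⁻ φ h¬φ (⊨Dφ v r)
    truth⁻ (C φ) {w} h ⊨Cφ with witness back-C (H9 (state w) φ h)
    ... | v , p , h¬φ = truth⁻ φ h¬φ (⊨Cφ v p)

lemma2 : (AP : Set) → AP → (n : ℕ) → 2 ≤ n → (θ : Form AP n) →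
         MAEHSFor θ → SatisfiableMAEM θ
lemma2 _ _ (suc (suc m)) (s≤s (s≤s _)) θ (𝓗 , s , θ∈H) =
  model , ledWorld (const (0 , s)) fzero s , truth⁺ θ θ∈H
  where
  open Unravelling 𝓗 (λ a → punchIn a fzero) (λ a → punchInᵢ≢i a fzero)
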